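{- Let $q$ be a prime power, let $m_1,m_2\ge1$, $s_1,s_2\ge1$ and $u_1,u_2\ge0$ be integers, and let $\mathbf{e}=(e_1,\dots,e_{s_1})\in\mathbb{N}^{s_1}$, $\mathbf{f}=(f_1,\dots,f_{s_2})\in\mathbb{N}^{s_2}$. If a digital $(u_1,m_1,\mathbf{e},s_1)$-net over $\mathbb{F}_q$ and a digital $(u_2,m_2,\mathbf{f},s_2)$-net over $\mathbb{F}_q$ are given, then one can construct a digital $(u,m_1+m_2,(\mathbf{e},\mathbf{f}),s_1+s_2)$-net over $\mathbb{F}_q$ with $u=\max\{m_1+u_2,m_2+u_1\}$ and $(\mathbf{e},\mathbf{f})=(e_1,\dots,e_{s_1},f_1,\dots,f_{s_2})\in\mathbb{N}^{s_1+s_2}$.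
   Context: $\mathbb{N}$ denotes the positive integers, $\lambda_s$ Lebesgue measure. An elementary interval in base $b$ is $J=\prod_{i=1}^s[a_ib^{ -d_i},(a_i+1)b^{ -d_i})$ with integers $d_i\ge0$, $0\le a_i<b^{d_i}$. For integers $0\le u\le m$ and $\mathbf{e}=(e_1,\dots,e_s)\in\mathbb{N}^s$, a set of $b^m$ points in $[0,1)^s$ is a $(u,m,\mathbf{e},s)$-net in base $b$ if every elementary interval $J$ in base $b$ with $\lambda_s(J)\ge b^{u-m}$ and $e_i\mid d_i$ for all $i$ contains exactly $b^m\lambda_s(J)$ of the points. Digital net over $\mathbb{F}_q$: given $m\times m$ generating matrices $C_1,\dots,C_s$ over $\mathbb{F}_q$, bijections $\eta_r:Z_q\to\mathbb{F}_q$ ($0\le r<m$) and $\kappa_{i,j}:\mathbb{F}_q\to Z_q$ where $Z_q=\{0,\dots,q-1\}$, for $0\le n<q^m$ with base-$q$ digits $n_0,\dots,n_{m-1}$ put $(y^{(i)}_{n,1},\dots,y^{(i)}_{n,m})^\top=C_i(\eta_0(n_0),\dots,\eta_{m-1}(n_{m-1}))^\top$, $x_n^{(i)}=\sum_{j=1}^m\kappa_{i,j}(y^{(i)}_{n,j})q^{ -j}$, $\mathbf{x}_n=(x_n^{(1)},\dots,x_n^{(s)})$. The resulting point set is a digital net over $\mathbb{F}_q$; it is a digital $(u,m,\mathbf{e},s)$-net over $\mathbb{F}_q$ if it is a $(u,m,\mathbf{e},s)$-net in base $q$. -}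

module Defs where

import Data.Nat.DivMod
open import Data.Nat using (ℕ; zero; suc; _+_; _*_; _∸_; _^_; _≤_; _<_; _<?_; NonZero; _/_; _%_)
open import Data.Nat.Properties using (_≟_)
open import Data.Nat.Primality using (Prime)
open import Data.Nat.Divisibility using (_∣_)
open import Data.Fin using (Fin; toℕ; fromℕ<)
import Data.Fin as Fin
open import Data.Fin.Properties using (all?)
open import Data.List using (length; filter; allFin)
open import Data.Product using (Σ; ∃; _×_; _,_)
open import Relation.Binary.PropositionalEquality using (_≡_; _≢_)
open import Relation.Nullary using (yes; no)
open import Algebra.Core using (Op₁; Op₂)
open import Algebra.Structures using (IsCommutativeRing)
open import Function.Bundles using (_⤖_; Bijection)

IsPrimePower : ℕ → Set
IsPrimePower q = Σ ℕ λ p → Σ ℕ λ k → Prime p × 1 ≤ k × q ≡ p ^ k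

-- A finite field with q elements, realised on the carrier Fin q
-- (every field with q elements is isomorphic to F_q).
record FiniteField (q : ℕ) : Set where
  field
    _+F_ _*F_ : Op₂ (Fin q)
    -F_ : Op₁ (Fin q)
    0F 1F : Fin q
    isCommutativeRing : IsCommutativeRing _≡_ _+F_ _*F_ -F_ 0F 1F
    0≢1 : 0F ≢ 1F
    inverse : ∀ x → x ≢ 0F → Σ (Fin q) λ y → x *F y ≡ 1F

∑ℕ : (s : ℕ) → (Fin s → ℕ) → ℕ
∑ℕ zero    d = 0
∑ℕ (suc s) d = d Fin.zero + ∑ℕ s (λ i → d (Fin.suc i))

count : (N : ℕ) {P : Fin N → Set} → (∀ n → Relation.Nullary.Dec (P n)) → ℕ
count N P? = length (filter P? (allFin N))

digit : (q : ℕ) .{{_ : NonZero q}} → ℕ → ℕ → ℕ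
digit q n zero    = n % q
digit q n (suc r) = digit q (n / q) r

digitAt : {b m : ℕ} → (Fin m → Fin b) → ℕ → ℕ
digitAt {m = m} x j with j <? m
... | yes j<m = toℕ (x (fromℕ< j<m))
... | no  _   = 0

-- floor(x * b^d) for x = ∑_{j=1}^m x_j b^{-j}
floorScaled : (b : ℕ) {m : ℕ} → (Fin m → Fin b) → ℕ → ℕ
floorScaled b x zero    = 0
floorScaled b x (suc d) = b * floorScaled b x d + digitAt x d

-- x ∈ [a b^{-d}, (a+1) b^{-d})  ⇔  floor(x b^d) = a.
-- A family of b^m points in [0,1)^s whose coordinates have m base-b digits
-- (x n i j = j-th digit, 0-indexed, of coordinate i of point n) is a
-- (u,m,e,s)-net in base b.  For an elementary interval with parameters
-- d, a: λ(J) = b^{-∑d}, so λ(J) ≥ b^{u-m} ⇔ ∑d + u ≤ m, and b^m λ(J) = b^{m-∑d}.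
IsNet : (b u m s : ℕ) → (e : Fin s → ℕ) → (Fin (b ^ m) → Fin s → Fin m → Fin b) → Set
IsNet b u m s e x =
  u ≤ m ×
  ((d a : Fin s → ℕ) → (∀ i → a i < b ^ d i) → (∀ i → e i ∣ d i) →
   ∑ℕ s d + u ≤ m →
   count (b ^ m) (λ n → all? (λ i → floorScaled b (x n i) (d i) ≟ a i))
     ≡ b ^ (m ∸ ∑ℕ s d))

record DigitalNetData {q : ℕ} (F : FiniteField q) (m s : ℕ) : Set where
  field
    C : Fin s → Fin m → Fin m → Fin q      -- C i j r : entry (row j, column r) of C_i
    η : Fin m → (Fin q ⤖ Fin q)           -- η_r : Z_q → F_q
    κ : Fin s → Fin m → (Fin q ⤖ Fin q)   -- κ_{i,j} : F_q → Z_q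

module _ {q : ℕ} (F : FiniteField q) where
  open FiniteField F

  ∑F : (k : ℕ) → (Fin k → Fin q) → Fin q
  ∑F zero    v = 0F
  ∑F (suc k) v = v Fin.zero +F ∑F k (λ r → v (Fin.suc r))

  netPoints : .{{_ : NonZero q}} → {m s : ℕ} → DigitalNetData F m s →
              Fin (q ^ m) → Fin s → Fin m → Fin q
  netPoints {m} {s} D n i j =
    Bijection.to (κ i j)
      (∑F m (λ r → C i j r *F Bijection.to (η r) (Data.Nat.DivMod._mod_ (digit q (toℕ n) (toℕ r)) q)))
    where open DigitalNetData D

  HasDigitalNet : .{{_ : NonZero q}} → (u m s : ℕ) → (Fin s → ℕ) → Set
  HasDigitalNet u m s e = Σ (DigitalNetData F m s) λ D → IsNet q u m s e (netPoints D)

module Submission where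

-- Given digital nets with data D₁ (m₁ × m₁ matrices, s₁ coordinates) and
-- D₂ (m₂ × m₂, s₂ coordinates), we build a digital net with m = m₁ + m₂ and
-- s₁ + s₂ coordinates whose generating matrices are block matrices:
-- coordinates of the first kind use  [C₁ 0 ; 0 0],  those of the second
-- kind use  [0 C₂ ; 0 0].  If the point index is n = hi·q^m₁ + lo
-- (lo < q^m₁), the first s₁ coordinates of point n are those of point lo of
-- the first net and the last s₂ coordinates are those of point hi of the
-- second net, up to the first m₁ (resp. m₂) digits.  So the new point set is
-- the Cartesian product of the two nets, and the number of points in an
-- elementary box J₁ × J₂ factors as (points of net 1 in J₁) · (points of net 2
-- in J₂).  If ∑d + max(m₁ + u₂, m₂ + u₁) ≤ m₁ + m₂, both boxes are admissible
-- for their nets, so the count is q^(m₁ ∸ ∑d₁) · q^(m₂ ∸ ∑d₂) = q^(m ∸ ∑d).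
--
-- The theorem then takes the product of the two given nets.

open import Defs
open import Data.Nat
  using (ℕ; zero; suc; _+_; _*_; _∸_; _^_; _≤_; _<_; _<?_; _⊔_; z≤n; s≤s; NonZero; _/_; _%_)
open import Data.Nat.Properties
open import Data.Nat.DivMod
  using (_mod_; +-distrib-/-∣ˡ; m*n/n≡m; [m+kn]%n≡m%n; m<n*o⇒m/o<n)
open import Data.Nat.Divisibility using (_∣_; n∣m*n)
open import Data.Fin as Fin using (Fin; toℕ; fromℕ<; _↑ˡ_; _↑ʳ_; splitAt)
open import Data.Fin.Properties
  using (all?; toℕ<n; toℕ-fromℕ<; fromℕ<-cong; splitAt-↑ˡ; splitAt-↑ʳ; splitAt⁻¹-↑ˡ; splitAt⁻¹-↑ʳ)
open import Data.List using (length; filter; tabulate)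
open import Data.Product using (_×_; _,_; proj₁; proj₂)
open import Data.Sum using (_⊎_; inj₁; inj₂; [_,_]′; map₁)
open import Data.Empty using (⊥-elim)
open import Data.Vec.Functional using (_++_; take; drop)
open import Data.Vec.Functional.Properties using (lookup-++ˡ; lookup-++ʳ)
open import Relation.Nullary using (Dec; yes; no)
open import Relation.Unary using (Decidable)
open import Relation.Binary.PropositionalEquality
  using (_≡_; refl; sym; trans; cong; cong₂; subst; module ≡-Reasoning)
open import Function.Bundles using (_⤖_; Bijection)
open import Function.Construct.Identity using (⤖-id)
open import Algebra.Structures using (IsCommutativeRing)

module Digits (q : ℕ) .{{_ : NonZero q}} where

  private
    reassoc : ∀ hi m → hi * (q * q ^ m) ≡ (hi * q ^ m) * q
    reassoc hi m = trans (cong (hi *_) (*-comm q (q ^ m))) (sym (*-assoc hi (q ^ m) q))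

    quot-step : ∀ hi m lo → (hi * (q * q ^ m) + lo) / q ≡ hi * q ^ m + lo / q
    quot-step hi m lo rewrite reassoc hi m =
      trans (+-distrib-/-∣ˡ lo (n∣m*n (hi * q ^ m))) (cong (_+ lo / q) (m*n/n≡m (hi * q ^ m) q))

    rem-step : ∀ hi m lo → (hi * (q * q ^ m) + lo) % q ≡ lo % q
    rem-step hi m lo rewrite reassoc hi m | +-comm (hi * q ^ m * q) lo =
      [m+kn]%n≡m%n lo (hi * q ^ m) q

    quot-bound : ∀ m lo → lo < q * q ^ m → lo / q < q ^ m
    quot-bound m lo p = m<n*o⇒m/o<n (subst (lo <_) (*-comm q (q ^ m)) p)

  digit-low : ∀ m hi lo r → lo < q ^ m → r < m → digit q (hi * q ^ m + lo) r ≡ digit q lo r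
  digit-low (suc m) hi lo zero    _ _ = rem-step hi m lo
  digit-low (suc m) hi lo (suc r) p (s≤s r<m) rewrite quot-step hi m lo =
    digit-low m hi (lo / q) r (quot-bound m lo p) r<m

  digit-high : ∀ m hi lo r → lo < q ^ m → digit q (hi * q ^ m + lo) (m + r) ≡ digit q hi r
  digit-high zero hi lo r p rewrite n<1⇒n≡0 p | *-identityʳ hi | +-identityʳ hi = refl
  digit-high (suc m) hi lo r p rewrite quot-step hi m lo =
    digit-high m hi (lo / q) r (quot-bound m lo p)

Σ< : ℕ → (ℕ → ℕ) → ℕ
Σ< zero    H = 0
Σ< (suc N) H = H 0 + Σ< N (λ n → H (suc n))

Σ<-cong : ∀ N F G → (∀ n → n < N → F n ≡ G n) → Σ< N F ≡ Σ< N G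
Σ<-cong zero    F G eq = refl
Σ<-cong (suc N) F G eq = cong₂ _+_ (eq 0 (s≤s z≤n)) (Σ<-cong N _ _ (λ n p → eq (suc n) (s≤s p)))

Σ<-+ : ∀ a N H → Σ< (a + N) H ≡ Σ< a H + Σ< N (λ n → H (a + n))
Σ<-+ zero    N H = refl
Σ<-+ (suc a) N H =
  trans (cong (H 0 +_) (Σ<-+ a N (λ n → H (suc n)))) (sym (+-assoc (H 0) _ _))

Σ<-* : ∀ b a H → Σ< (b * a) H ≡ Σ< b (λ j → Σ< a (λ i → H (j * a + i)))
Σ<-* zero    a H = refl
Σ<-* (suc b) a H = trans (Σ<-+ a (b * a) H) (cong (Σ< a H +_)
  (trans (Σ<-* b a (λ n → H (a + n)))
         (Σ<-cong b _ _ (λ j _ → Σ<-cong a _ _ (λ i _ → cong H (sym (+-assoc a (j * a) i)))))))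

Σ<-*ˡ : ∀ N c F → Σ< N (λ n → c * F n) ≡ c * Σ< N F
Σ<-*ˡ zero    c F = sym (*-zeroʳ c)
Σ<-*ˡ (suc N) c F =
  trans (cong (c * F 0 +_) (Σ<-*ˡ N c (λ n → F (suc n)))) (sym (*-distribˡ-+ c _ _))

Σ<-*ʳ : ∀ N c F → Σ< N (λ n → F n * c) ≡ Σ< N F * c
Σ<-*ʳ N c F = trans (Σ<-cong N _ _ (λ n _ → *-comm (F n) c)) (trans (Σ<-*ˡ N c F) (*-comm c _))

Σ<-product : ∀ b a H A B → (∀ j i → j < b → i < a → H (j * a + i) ≡ A i * B j) →
             Σ< (b * a) H ≡ Σ< a A * Σ< b B
Σ<-product b a H A B eq = begin
  Σ< (b * a) H                                  ≡⟨ Σ<-* b a H ⟩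
  Σ< b (λ j → Σ< a (λ i → H (j * a + i)))       ≡⟨ Σ<-cong b _ _ (λ j j<b →
                                                     trans (Σ<-cong a _ _ (λ i i<a → eq j i j<b i<a))
                                                           (Σ<-*ʳ a (B j) A)) ⟩
  Σ< b (λ j → Σ< a A * B j)                     ≡⟨ Σ<-*ˡ b (Σ< a A) B ⟩
  Σ< a A * Σ< b B                               ∎
  where open ≡-Reasoning

indicator : {X : Set} → Dec X → ℕ
indicator (yes _) = 1
indicator (no _)  = 0

indicator-× : {X Y Z : Set} (x? : Dec X) (y? : Dec Y) (z? : Dec Z) →
              (X → Y × Z) → (Y × Z → X) → indicator x? ≡ indicator y? * indicator z?
indicator-× (yes x) (yes y) (yes z) to from = refl
indicator-× (yes x) (yes y) (no ¬z) to from = ⊥-elim (¬z (proj₂ (to x)))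
indicator-× (yes x) (no ¬y) z?      to from = ⊥-elim (¬y (proj₁ (to x)))
indicator-× (no ¬x) (yes y) (yes z) to from = ⊥-elim (¬x (from (y , z)))
indicator-× (no ¬x) (yes y) (no ¬z) to from = refl
indicator-× (no ¬x) (no ¬y) z?      to from = refl

length-filter-tabulate : ∀ {A : Set} {P : A → Set} (P? : Decidable P) k (g : Fin k → A) →
                         length (filter P? (tabulate g)) ≡ ∑ℕ k (λ n → indicator (P? (g n)))
length-filter-tabulate P? zero    g = refl
length-filter-tabulate P? (suc k) g with P? (g Fin.zero)
... | yes _ = cong suc (length-filter-tabulate P? k (λ n → g (Fin.suc n)))
... | no _  = length-filter-tabulate P? k (λ n → g (Fin.suc n))

∑ℕ-Σ< : ∀ N (h : Fin N → ℕ) H → (∀ n → h n ≡ H (toℕ n)) → ∑ℕ N h ≡ Σ< N H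
∑ℕ-Σ< zero    h H eq = refl
∑ℕ-Σ< (suc N) h H eq = cong₂ _+_ (eq Fin.zero) (∑ℕ-Σ< N _ _ (λ n → eq (Fin.suc n)))

count-Σ< : ∀ N {P : ℕ → Set} (P? : Decidable P) →
           count N (λ n → P? (toℕ n)) ≡ Σ< N (λ n → indicator (P? n))
count-Σ< N P? =
  trans (length-filter-tabulate (λ n → P? (toℕ n)) N (λ n → n)) (∑ℕ-Σ< N _ _ (λ n → refl))

strength-≤ : ∀ {u₁ u₂ m₁ m₂} → u₁ ≤ m₁ → u₂ ≤ m₂ → (m₁ + u₂) ⊔ (m₂ + u₁) ≤ m₁ + m₂
strength-≤ {u₁} {u₂} {m₁} {m₂} u₁≤m₁ u₂≤m₂ =
  ⊔-lub (+-monoʳ-≤ m₁ u₂≤m₂) (subst (m₂ + u₁ ≤_) (+-comm m₂ m₁) (+-monoʳ-≤ m₂ u₁≤m₁))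

cancel-budget : ∀ S u m k → S + (k + u) ≤ m + k → S + u ≤ m
cancel-budget S u m k le =
  +-cancelʳ-≤ k (S + u) m
    (subst (_≤ m + k) (trans (cong (S +_) (+-comm k u)) (sym (+-assoc S u k))) le)

admissible-split : ∀ S₁ S₂ u₁ u₂ m₁ m₂ → (S₁ + S₂) + ((m₁ + u₂) ⊔ (m₂ + u₁)) ≤ m₁ + m₂ →
                   S₁ + u₁ ≤ m₁ × S₂ + u₂ ≤ m₂
admissible-split S₁ S₂ u₁ u₂ m₁ m₂ bound =
  ≤-trans (+-monoˡ-≤ u₁ (m≤m+n S₁ S₂)) (cancel-budget (S₁ + S₂) u₁ m₁ m₂ room₁) ,
  ≤-trans (+-monoˡ-≤ u₂ (m≤n+m S₂ S₁)) (cancel-budget (S₁ + S₂) u₂ m₂ m₁ room₂)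
  where
  room₁ : (S₁ + S₂) + (m₂ + u₁) ≤ m₁ + m₂
  room₁ = ≤-trans (+-monoʳ-≤ (S₁ + S₂) (m≤n⊔m (m₁ + u₂) (m₂ + u₁))) bound
  room₂ : (S₁ + S₂) + (m₁ + u₂) ≤ m₂ + m₁
  room₂ = subst ((S₁ + S₂) + (m₁ + u₂) ≤_) (+-comm m₁ m₂)
            (≤-trans (+-monoʳ-≤ (S₁ + S₂) (m≤m⊔n (m₁ + u₂) (m₂ + u₁))) bound)

∸-+-interchange : ∀ {m₁ m₂ S₁ S₂} → S₁ ≤ m₁ → S₂ ≤ m₂ →
                  (m₁ ∸ S₁) + (m₂ ∸ S₂) ≡ (m₁ + m₂) ∸ (S₁ + S₂)
∸-+-interchange {m₁} {m₂} {S₁} {S₂} S₁≤m₁ S₂≤m₂ = begin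
  (m₁ ∸ S₁) + (m₂ ∸ S₂)   ≡⟨ sym (+-∸-assoc (m₁ ∸ S₁) S₂≤m₂) ⟩
  ((m₁ ∸ S₁) + m₂) ∸ S₂   ≡⟨ cong (_∸ S₂) (sym (+-∸-comm m₂ S₁≤m₁)) ⟩
  ((m₁ + m₂) ∸ S₁) ∸ S₂   ≡⟨ ∸-+-assoc (m₁ + m₂) S₁ S₂ ⟩
  (m₁ + m₂) ∸ (S₁ + S₂)   ∎
  where open ≡-Reasoning

∑ℕ-split : ∀ s₁ s₂ (d : Fin (s₁ + s₂) → ℕ) → ∑ℕ (s₁ + s₂) d ≡ ∑ℕ s₁ (take s₁ d) + ∑ℕ s₂ (drop s₁ d)
∑ℕ-split zero     s₂ d = refl
∑ℕ-split (suc s₁) s₂ d =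
  trans (cong (d Fin.zero +_) (∑ℕ-split s₁ s₂ (λ i → d (Fin.suc i))))
        (sym (+-assoc (d Fin.zero) _ _))

∑ℕ-≥-term : ∀ s (d : Fin s → ℕ) i → d i ≤ ∑ℕ s d
∑ℕ-≥-term (suc s) d Fin.zero    = m≤m+n _ _
∑ℕ-≥-term (suc s) d (Fin.suc i) = ≤-trans (∑ℕ-≥-term s (λ k → d (Fin.suc k)) i) (m≤n+m _ _)

term-≤-size : ∀ s (d : Fin s → ℕ) u m → ∑ℕ s d + u ≤ m → ∀ i → d i ≤ m
term-≤-size s d u m fits i = ≤-trans (∑ℕ-≥-term s d i) (m+n≤o⇒m≤o (∑ℕ s d) fits)

all-split : ∀ s₁ s₂ (P : Fin (s₁ + s₂) → Set) →
            (∀ i → P (i ↑ˡ s₂)) → (∀ i → P (s₁ ↑ʳ i)) → ∀ i → P i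
all-split s₁ s₂ P left right i with splitAt s₁ i in eq
... | inj₁ k = subst P (splitAt⁻¹-↑ˡ eq) (left k)
... | inj₂ k = subst P (splitAt⁻¹-↑ʳ eq) (right k)

digitAt-agree : ∀ {b} m M → m ≤ M → (x : Fin M → Fin b) (y : Fin m → Fin b) →
                (∀ j (p : toℕ j < m) → x j ≡ y (fromℕ< p)) → ∀ j → j < m → digitAt x j ≡ digitAt y j
digitAt-agree m M m≤M x y agree j j<m with j <? M | j <? m
... | yes j<M | yes _ =
  cong toℕ (trans (agree (fromℕ< j<M) j<M′) (cong y (fromℕ<-cong _ j (toℕ-fromℕ< j<M) j<M′ j<m)))
  where j<M′ = subst (_< m) (sym (toℕ-fromℕ< j<M)) j<m
... | _       | no j≮m = ⊥-elim (j≮m j<m)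
... | no j≮M  | _      = ⊥-elim (j≮M (≤-trans j<m m≤M))

floorScaled-agree : ∀ {b M m} (x : Fin M → Fin b) (y : Fin m → Fin b) d →
                    (∀ j → j < d → digitAt x j ≡ digitAt y j) →
                    floorScaled b x d ≡ floorScaled b y d
floorScaled-agree x y zero    agree = refl
floorScaled-agree {b} x y (suc d) agree =
  cong₂ (λ hi lo → b * hi + lo) (floorScaled-agree x y d (λ j j<d → agree j (m<n⇒m<1+n j<d)))
                                (agree d ≤-refl)

onFirst : {A : Set} (m : ℕ) {M : ℕ} → (Fin m → A) → A → Fin M → A
onFirst m g z j with toℕ j <? m
... | yes p = g (fromℕ< p)
... | no _  = z

onFirst-< : {A : Set} (m : ℕ) {M : ℕ} (g : Fin m → A) (z : A) (j : Fin M) (p : toℕ j < m) →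
            onFirst m g z j ≡ g (fromℕ< p)
onFirst-< m g z j p with toℕ j <? m
... | yes _  = refl
... | no j≮m = ⊥-elim (j≮m p)

module _ {q : ℕ} .{{_ : NonZero q}} (F : FiniteField q) where
  open FiniteField F
  open IsCommutativeRing isCommutativeRing
    using () renaming ( +-identityˡ to +F-identityˡ; +-identityʳ to +F-identityʳ
                      ; +-assoc to +F-assoc; zeroˡ to *F-zeroˡ)

  ∑F-cong : ∀ k (v w : Fin k → Fin q) → (∀ r → v r ≡ w r) → ∑F F k v ≡ ∑F F k w
  ∑F-cong zero    v w eq = refl
  ∑F-cong (suc k) v w eq = cong₂ _+F_ (eq Fin.zero) (∑F-cong k _ _ (λ r → eq (Fin.suc r)))

  ∑F-zero : ∀ k (v : Fin k → Fin q) → (∀ r → v r ≡ 0F) → ∑F F k v ≡ 0F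
  ∑F-zero zero    v eq = refl
  ∑F-zero (suc k) v eq =
    trans (cong₂ _+F_ (eq Fin.zero) (∑F-zero k _ (λ r → eq (Fin.suc r)))) (+F-identityˡ 0F)

  ∑F-splitAt : ∀ a b (w : Fin a ⊎ Fin b → ℕ → Fin q) →
               ∑F F (a + b) (λ r → w (splitAt a r) (toℕ r))
               ≡ ∑F F a (λ r → w (inj₁ r) (toℕ r)) +F ∑F F b (λ r → w (inj₂ r) (a + toℕ r))
  ∑F-splitAt zero    b w = sym (+F-identityˡ _)
  ∑F-splitAt (suc a) b w =
    trans (cong (w (inj₁ Fin.zero) 0 +F_)
                (∑F-splitAt a b (λ c t → w (map₁ Fin.suc c) (suc t))))
          (sym (+F-assoc _ _ _))

  coord : {m s : ℕ} → DigitalNetData F m s → (ℕ → ℕ) → Fin s → Fin m → Fin q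
  coord {m} D dig i j =
    Bijection.to (κ i j) (∑F F m (λ r → C i j r *F Bijection.to (η r) (dig (toℕ r) mod q)))
    where open DigitalNetData D

  coord-cong : ∀ {m s} (D : DigitalNetData F m s) dig dig′ →
               (∀ r → r < m → dig r ≡ dig′ r) → ∀ i j → coord D dig i j ≡ coord D dig′ i j
  coord-cong {m} D dig dig′ eq i j = cong (Bijection.to (κ i j)) (∑F-cong m _ _ (λ r →
    cong (λ t → C i j r *F Bijection.to (η r) (t mod q)) (eq (toℕ r) (toℕ<n r))))
    where open DigitalNetData D

  point : {m s : ℕ} → DigitalNetData F m s → ℕ → Fin s → Fin m → Fin q
  point D n = coord D (digit q n)

  inBox : {m s : ℕ} (pt : ℕ → Fin s → Fin m → Fin q) (d a : Fin s → ℕ) →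
          Decidable (λ n → ∀ i → floorScaled q (pt n i) (d i) ≡ a i)
  inBox pt d a n = all? (λ i → floorScaled q (pt n i) (d i) ≟ a i)

  module Product {m₁ m₂ s₁ s₂ : ℕ} (D₁ : DigitalNetData F m₁ s₁) (D₂ : DigitalNetData F m₂ s₂) where
    private
      module N₁ = DigitalNetData D₁
      module N₂ = DigitalNetData D₂

    M : ℕ
    M = m₁ + m₂

    C-left : Fin s₁ → Fin M → Fin M → Fin q
    C-left i j r = onFirst m₁ (λ j₁ → [ N₁.C i j₁ , (λ _ → 0F) ]′ (splitAt m₁ r)) 0F j

    C-right : Fin s₂ → Fin M → Fin M → Fin q
    C-right i j r = onFirst m₂ (λ j₂ → [ (λ _ → 0F) , N₂.C i j₂ ]′ (splitAt m₁ r)) 0F j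

    κ-left : Fin s₁ → Fin M → (Fin q ⤖ Fin q)
    κ-left i = onFirst m₁ (N₁.κ i) (⤖-id (Fin q))

    κ-right : Fin s₂ → Fin M → (Fin q ⤖ Fin q)
    κ-right i = onFirst m₂ (N₂.κ i) (⤖-id (Fin q))

    product : DigitalNetData F M (s₁ + s₂)
    product = record
      { C = λ i → [ C-left , C-right ]′ (splitAt s₁ i)
      ; η = λ r → [ N₁.η , N₂.η ]′ (splitAt m₁ r)
      ; κ = λ i → [ κ-left , κ-right ]′ (splitAt s₁ i)
      }

    coord-left : ∀ dig i (j : Fin M) (p : toℕ j < m₁) →
                 coord product dig (i ↑ˡ s₂) j ≡ coord D₁ dig i (fromℕ< p)
    coord-left dig i j p rewrite splitAt-↑ˡ s₁ i s₂ =
      cong₂ Bijection.to (onFirst-< m₁ (N₁.κ i) _ j p) (begin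
        ∑F F M (λ r → C-left i j r *F η r (dig (toℕ r)))
          ≡⟨ ∑F-cong M _ _ (λ r → cong (_*F _) (onFirst-< m₁ _ 0F j p)) ⟩
        ∑F F M (λ r → row (splitAt m₁ r) *F η r (dig (toℕ r)))
          ≡⟨ ∑F-splitAt m₁ m₂ (λ c t → row c *F Bijection.to ([ N₁.η , N₂.η ]′ c) (dig t mod q)) ⟩
        ∑F F m₁ (λ r → N₁.C i j′ r *F Bijection.to (N₁.η r) (dig (toℕ r) mod q)) +F
        ∑F F m₂ (λ r → 0F *F Bijection.to (N₂.η r) (dig (m₁ + toℕ r) mod q))
          ≡⟨ cong₂ _+F_ refl (∑F-zero m₂ _ (λ r → *F-zeroˡ _)) ⟩
        ∑F F m₁ (λ r → N₁.C i j′ r *F Bijection.to (N₁.η r) (dig (toℕ r) mod q)) +F 0F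
          ≡⟨ +F-identityʳ _ ⟩
        ∑F F m₁ (λ r → N₁.C i j′ r *F Bijection.to (N₁.η r) (dig (toℕ r) mod q)) ∎)
      where
      open ≡-Reasoning
      j′ : Fin m₁
      j′ = fromℕ< p
      row : Fin m₁ ⊎ Fin m₂ → Fin q
      row = [ N₁.C i j′ , (λ _ → 0F) ]′
      η : Fin M → ℕ → Fin q
      η r t = Bijection.to ([ N₁.η , N₂.η ]′ (splitAt m₁ r)) (t mod q)

    coord-right : ∀ dig i (j : Fin M) (p : toℕ j < m₂) →
                  coord product dig (s₁ ↑ʳ i) j ≡ coord D₂ (λ t → dig (m₁ + t)) i (fromℕ< p)
    coord-right dig i j p rewrite splitAt-↑ʳ s₁ s₂ i =
      cong₂ Bijection.to (onFirst-< m₂ (N₂.κ i) _ j p) (begin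
        ∑F F M (λ r → C-right i j r *F η r (dig (toℕ r)))
          ≡⟨ ∑F-cong M _ _ (λ r → cong (_*F _) (onFirst-< m₂ _ 0F j p)) ⟩
        ∑F F M (λ r → row (splitAt m₁ r) *F η r (dig (toℕ r)))
          ≡⟨ ∑F-splitAt m₁ m₂ (λ c t → row c *F Bijection.to ([ N₁.η , N₂.η ]′ c) (dig t mod q)) ⟩
        ∑F F m₁ (λ r → 0F *F Bijection.to (N₁.η r) (dig (toℕ r) mod q)) +F
        ∑F F m₂ (λ r → N₂.C i j′ r *F Bijection.to (N₂.η r) (dig (m₁ + toℕ r) mod q))
          ≡⟨ cong₂ _+F_ (∑F-zero m₁ _ (λ r → *F-zeroˡ _)) refl ⟩
        0F +F ∑F F m₂ (λ r → N₂.C i j′ r *F Bijection.to (N₂.η r) (dig (m₁ + toℕ r) mod q))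
          ≡⟨ +F-identityˡ _ ⟩
        ∑F F m₂ (λ r → N₂.C i j′ r *F Bijection.to (N₂.η r) (dig (m₁ + toℕ r) mod q)) ∎)
      where
      open ≡-Reasoning
      j′ : Fin m₂
      j′ = fromℕ< p
      row : Fin m₁ ⊎ Fin m₂ → Fin q
      row = [ (λ _ → 0F) , N₂.C i j′ ]′
      η : Fin M → ℕ → Fin q
      η r t = Bijection.to ([ N₁.η , N₂.η ]′ (splitAt m₁ r)) (t mod q)

    module _ (hi lo : ℕ) (lo<q^m₁ : lo < q ^ m₁) where
      open Digits q

      n : ℕ
      n = hi * q ^ m₁ + lo

      floor-left : ∀ i d → d ≤ m₁ →
                   floorScaled q (point product n (i ↑ˡ s₂)) d ≡ floorScaled q (point D₁ lo i) d
      floor-left i d d≤m₁ = floorScaled-agree _ _ d (λ j j<d →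
        digitAt-agree m₁ M (m≤m+n m₁ m₂) _ _ (λ j p →
          trans (coord-left (digit q n) i j p)
                (coord-cong D₁ _ _ (λ r r<m₁ → digit-low m₁ hi lo r lo<q^m₁ r<m₁) i (fromℕ< p)))
          j (≤-trans j<d d≤m₁))

      floor-right : ∀ i d → d ≤ m₂ →
                    floorScaled q (point product n (s₁ ↑ʳ i)) d ≡ floorScaled q (point D₂ hi i) d
      floor-right i d d≤m₂ = floorScaled-agree _ _ d (λ j j<d →
        digitAt-agree m₂ M (m≤n+m m₂ m₁) _ _ (λ j p →
          trans (coord-right (digit q n) i j p)
                (coord-cong D₂ _ _ (λ r _ → digit-high m₁ hi lo r lo<q^m₁) i (fromℕ< p)))
          j (≤-trans j<d d≤m₂))

    box-factor : ∀ d a → (∀ i → take s₁ d i ≤ m₁) → (∀ i → drop s₁ d i ≤ m₂) →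
                 ∀ hi lo → lo < q ^ m₁ →
                 indicator (inBox (point product) d a (hi * q ^ m₁ + lo))
                 ≡ indicator (inBox (point D₁) (take s₁ d) (take s₁ a) lo)
                   * indicator (inBox (point D₂) (drop s₁ d) (drop s₁ a) hi)
    box-factor d a d≤m₁ d≤m₂ hi lo lo< =
      indicator-× (inBox (point product) d a (hi * q ^ m₁ + lo))
                  (inBox (point D₁) (take s₁ d) (take s₁ a) lo)
                  (inBox (point D₂) (drop s₁ d) (drop s₁ a) hi)
      (λ inside → (λ i → trans (sym (floor-left hi lo lo< i _ (d≤m₁ i))) (inside (i ↑ˡ s₂)))
                , (λ i → trans (sym (floor-right hi lo lo< i _ (d≤m₂ i))) (inside (s₁ ↑ʳ i))))
      (λ (inside₁ , inside₂) → all-split s₁ s₂ _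
        (λ i → trans (floor-left hi lo lo< i _ (d≤m₁ i)) (inside₁ i))
        (λ i → trans (floor-right hi lo lo< i _ (d≤m₂ i)) (inside₂ i)))

    count-factor : ∀ d a → (∀ i → take s₁ d i ≤ m₁) → (∀ i → drop s₁ d i ≤ m₂) →
                   count (q ^ M) (λ k → inBox (point product) d a (toℕ k))
                   ≡ count (q ^ m₁) (λ k → inBox (point D₁) (take s₁ d) (take s₁ a) (toℕ k))
                     * count (q ^ m₂) (λ k → inBox (point D₂) (drop s₁ d) (drop s₁ a) (toℕ k))
    count-factor d a d≤m₁ d≤m₂ = begin
      count (q ^ M) (λ k → inBox (point product) d a (toℕ k))
        ≡⟨ count-Σ< (q ^ M) (inBox (point product) d a) ⟩
      Σ< (q ^ M) hits
        ≡⟨ cong (λ N → Σ< N hits) (trans (^-distribˡ-+-* q m₁ m₂) (*-comm (q ^ m₁) (q ^ m₂))) ⟩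
      Σ< (q ^ m₂ * q ^ m₁) hits
        ≡⟨ Σ<-product (q ^ m₂) (q ^ m₁) _ _ _ (λ hi lo _ lo< → box-factor d a d≤m₁ d≤m₂ hi lo lo<) ⟩
      Σ< (q ^ m₁) (λ k → indicator (inBox (point D₁) (take s₁ d) (take s₁ a) k))
      * Σ< (q ^ m₂) (λ k → indicator (inBox (point D₂) (drop s₁ d) (drop s₁ a) k))
        ≡⟨ sym (cong₂ _*_ (count-Σ< (q ^ m₁) _) (count-Σ< (q ^ m₂) _)) ⟩
      count (q ^ m₁) (λ k → inBox (point D₁) (take s₁ d) (take s₁ a) (toℕ k))
      * count (q ^ m₂) (λ k → inBox (point D₂) (drop s₁ d) (drop s₁ a) (toℕ k)) ∎
      where
      open ≡-Reasoning
      hits : ℕ → ℕ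
      hits k = indicator (inBox (point product) d a k)

    product-isNet : ∀ u₁ u₂ (e : Fin s₁ → ℕ) (f : Fin s₂ → ℕ) →
                    IsNet q u₁ m₁ s₁ e (netPoints F D₁) → IsNet q u₂ m₂ s₂ f (netPoints F D₂) →
                    IsNet q ((m₁ + u₂) ⊔ (m₂ + u₁)) M (s₁ + s₂) (e ++ f) (netPoints F product)
    product-isNet u₁ u₂ e f (u₁≤m₁ , net₁) (u₂≤m₂ , net₂) = strength-≤ u₁≤m₁ u₂≤m₂ , box-count
      where
      box-count : ∀ d a → (∀ i → a i < q ^ d i) → (∀ i → (e ++ f) i ∣ d i) →
                  ∑ℕ (s₁ + s₂) d + ((m₁ + u₂) ⊔ (m₂ + u₁)) ≤ M →
                  count (q ^ M) (λ k → inBox (point product) d a (toℕ k)) ≡ q ^ (M ∸ ∑ℕ (s₁ + s₂) d)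
      box-count d a a<q^d e∣d bound = begin
        count (q ^ M) (λ k → inBox (point product) d a (toℕ k))
          ≡⟨ count-factor d a (term-≤-size s₁ _ u₁ m₁ fits₁) (term-≤-size s₂ _ u₂ m₂ fits₂) ⟩
        count (q ^ m₁) (λ k → inBox (point D₁) (take s₁ d) (take s₁ a) (toℕ k))
        * count (q ^ m₂) (λ k → inBox (point D₂) (drop s₁ d) (drop s₁ a) (toℕ k))
          ≡⟨ cong₂ _*_ (net₁ (take s₁ d) (take s₁ a) (λ i → a<q^d _) e∣d₁ fits₁)
                       (net₂ (drop s₁ d) (drop s₁ a) (λ i → a<q^d _) f∣d₂ fits₂) ⟩
        q ^ (m₁ ∸ S₁) * q ^ (m₂ ∸ S₂)
          ≡⟨ sym (^-distribˡ-+-* q (m₁ ∸ S₁) (m₂ ∸ S₂)) ⟩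
        q ^ ((m₁ ∸ S₁) + (m₂ ∸ S₂))
          ≡⟨ cong (q ^_) (∸-+-interchange (m+n≤o⇒m≤o S₁ fits₁) (m+n≤o⇒m≤o S₂ fits₂)) ⟩
        q ^ (M ∸ (S₁ + S₂))
          ≡⟨ cong (λ S → q ^ (M ∸ S)) (sym (∑ℕ-split s₁ s₂ d)) ⟩
        q ^ (M ∸ ∑ℕ (s₁ + s₂) d) ∎
        where
        open ≡-Reasoning
        S₁ = ∑ℕ s₁ (take s₁ d)
        S₂ = ∑ℕ s₂ (drop s₁ d)

        fits : S₁ + u₁ ≤ m₁ × S₂ + u₂ ≤ m₂
        fits = admissible-split S₁ S₂ u₁ u₂ m₁ m₂
                 (subst (λ S → S + ((m₁ + u₂) ⊔ (m₂ + u₁)) ≤ M) (∑ℕ-split s₁ s₂ d) bound)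
        fits₁ = proj₁ fits
        fits₂ = proj₂ fits

        e∣d₁ : ∀ i → e i ∣ take s₁ d i
        e∣d₁ i = subst (_∣ _) (lookup-++ˡ e f i) (e∣d (i ↑ˡ s₂))

        f∣d₂ : ∀ i → f i ∣ drop s₁ d i
        f∣d₂ i = subst (_∣ _) (lookup-++ʳ e f i) (e∣d (s₁ ↑ʳ i))

theorem1 : (q : ℕ) .{{_ : NonZero q}} → IsPrimePower q → (F : FiniteField q) →
           (m₁ m₂ s₁ s₂ u₁ u₂ : ℕ) → 1 ≤ m₁ → 1 ≤ m₂ → 1 ≤ s₁ → 1 ≤ s₂ →
           (e : Fin s₁ → ℕ) → (f : Fin s₂ → ℕ) → (∀ i → 1 ≤ e i) → (∀ i → 1 ≤ f i) →
           HasDigitalNet F u₁ m₁ s₁ e → HasDigitalNet F u₂ m₂ s₂ f →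
           HasDigitalNet F ((m₁ + u₂) ⊔ (m₂ + u₁)) (m₁ + m₂) (s₁ + s₂) (e ++ f)
theorem1 q _ F m₁ m₂ s₁ s₂ u₁ u₂ _ _ _ _ e f _ _ (D₁ , isNet₁) (D₂ , isNet₂) =
  product , product-isNet u₁ u₂ e f isNet₁ isNet₂
  where open Product F D₁ D₂
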